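{- Consider the seven substitutions $\sigma_1,\dots,\sigma_7$ of $\{a,b,c\}^\ast$ given by $(\sigma_i(a),\sigma_i(b),\sigma_i(c))$ equal to $\sigma_1: (ba,\,ca,\,bac)$; $\sigma_2: (ac,\,ab,\,acb)$; $\sigma_3: (ca,\,ba,\,cba)$; $\sigma_4: (ab,\,ac,\,bac)$; $\sigma_5: (ba,\,cb,\,aca)$; $\sigma_6: (ac,\,ba,\,cab)$; $\sigma_7: (cb,\,ac,\,aba)$ (so that the words $\sigma_i(abc)$ run through the cyclic conjugates of $bacabac$, starting with $\sigma_1$, which corresponds to the Phrygian minor mode). Then: (i) $\sigma_1,\sigma_2,\sigma_3,\sigma_4,\sigma_6$ are authentic PWWF substitutions, while $\sigma_5$ and $\sigma_7$ are not; (ii) each of $\sigma_1,\sigma_2,\sigma_3,\sigma_4$ is a finite composition of letter permutations $E_{xy}$ and substitutions of the types $A_{xy}$ and $P_{xy}$ (hence a positive automorphism of the free group $F_3$ on $a,b,c$); (iii) $\sigma_6$ (the Ionian major mode $ac|ba||cab$) is not an automorphism of $F_3$.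
   Context: $\pi_{x\to y}$ (for distinct $x,y\in\{a,b,c\}$) is the monoid morphism replacing each $x$ by $y$ and fixing the other letters. For a substitution $\sigma$ of $\{a,b,c\}^\ast$: $\pi_{b\to c}(\sigma)$ on $\{a,c\}^\ast$ sends $a\mapsto\pi_{b\to c}(\sigma(a))$, $c\mapsto \pi_{b\to c}(\sigma(bc))$; $\pi_{a\to b}(\sigma)$ on $\{b,c\}^\ast$ sends $b\mapsto\pi_{a\to b}(\sigma(ab))$, $c\mapsto\pi_{a\to b}(\sigma(c))$; $\pi_{c\to a}(\sigma)$ on $\{a,b\}^\ast$ sends $a\mapsto \pi_{c\to a}(\sigma(ab))$, $b\mapsto\pi_{c\to a}(\sigma(c))$. For an ordered two-letter alphabet $(x,y)$, special Sturmian morphisms are the elements of the monoid generated by $G: x\mapsto x, y\mapsto xy$; $\tilde G: x\mapsto x, y\mapsto yx$; $D: x\mapsto yx, y\mapsto y$; $\tilde D: x\mapsto xy, y\mapsto y$ (use orders $(a,c)$, $(b,c)$, $(a,b)$). $\sigma$ is an authentic PWWF substitution iff all three projections $\pi_{b\to c}(\sigma),\pi_{a\to b}(\sigma),\pi_{c\to a}(\sigma)$ are special Sturmian morphisms. For distinct letters $x,y$ with $z$ the third letter, define morphisms $E_{xy}: x\mapsto y, y\mapsto x, z\mapsto z$; $A_{xy}: x\mapsto xy, y\mapsto y, z\mapsto z$; $P_{xy}: x\mapsto yx, y\mapsto y, z\mapsto z$. -}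

module Defs where

open import Data.Bool using (Bool; true; false; if_then_else_; not)
open import Data.List using (List; []; _∷_; _++_; concatMap; foldr; reverse; map)
open import Data.Product using (Σ; _×_; _,_)
open import Relation.Binary.PropositionalEquality using (_≡_; refl)
open import Relation.Nullary using (¬_)

data Letter : Set where
  a b c : Letter

_==_ : Letter → Letter → Bool
a == a = true
b == b = true
c == c = true
_ == _ = false

Word : Set
Word = List Letter

Subst : Set
Subst = Letter → Word

apply : Subst → Word → Word
apply σ w = concatMap σ w

_∘ˢ_ : Subst → Subst → Subst
(σ ∘ˢ τ) l = apply σ (τ l)

idˢ : Subst
idˢ l = l ∷ []

π : Letter → Letter → Word → Word
π x y w = map (λ l → if l == x then y else l) w

-- A morphism of a two-letter alphabet (x,y) is represented by the pair
-- (image of x , image of y).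
Mor2 : Set
Mor2 = Word × Word

π-b→c : Subst → Mor2
π-b→c σ = π b c (σ a) , π b c (σ b ++ σ c)

π-a→b : Subst → Mor2
π-a→b σ = π a b (σ a ++ σ b) , π a b (σ c)

π-c→a : Subst → Mor2
π-c→a σ = π c a (σ a ++ σ b) , π c a (σ c)

apply2 : Letter → Letter → Mor2 → Word → Word
apply2 x y (u , v) w =
  concatMap (λ l → if l == x then u else (if l == y then v else l ∷ [])) w

comp2 : Letter → Letter → Mor2 → Mor2 → Mor2
comp2 x y φ (u , v) = apply2 x y φ u , apply2 x y φ v

id2 : Letter → Letter → Mor2
id2 x y = x ∷ [] , y ∷ []

data SturmGen (x y : Letter) : Mor2 → Set where
  G  : SturmGen x y (x ∷ [] , x ∷ y ∷ [])
  G~ : SturmGen x y (x ∷ [] , y ∷ x ∷ [])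
  D  : SturmGen x y (y ∷ x ∷ [] , y ∷ [])
  D~ : SturmGen x y (x ∷ y ∷ [] , y ∷ [])

data SpecialSturmian (x y : Letter) : Mor2 → Set where
  sid   : SpecialSturmian x y (id2 x y)
  sstep : ∀ {φ γ} → SpecialSturmian x y φ → SturmGen x y γ →
          SpecialSturmian x y (comp2 x y φ γ)

AuthenticPWWF : Subst → Set
AuthenticPWWF σ =
  SpecialSturmian a c (π-b→c σ) ×
  SpecialSturmian b c (π-a→b σ) ×
  SpecialSturmian a b (π-c→a σ)

Eˢ : Letter → Letter → Subst
Eˢ x y l = if l == x then y ∷ [] else (if l == y then x ∷ [] else l ∷ [])

Aˢ : Letter → Letter → Subst
Aˢ x y l = if l == x then x ∷ y ∷ [] else l ∷ []

Pˢ : Letter → Letter → Subst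
Pˢ x y l = if l == x then y ∷ x ∷ [] else l ∷ []

data ElemMor : Set where
  E A P : (x y : Letter) → ¬ (x ≡ y) → ElemMor

⟦_⟧ᵉ : ElemMor → Subst
⟦ E x y _ ⟧ᵉ = Eˢ x y
⟦ A x y _ ⟧ᵉ = Aˢ x y
⟦ P x y _ ⟧ᵉ = Pˢ x y

composeAll : List ElemMor → Subst
composeAll = foldr (λ e τ → ⟦ e ⟧ᵉ ∘ˢ τ) idˢ

IsEAPComposition : Subst → Set
IsEAPComposition σ = Σ (List ElemMor) λ es → ∀ l → composeAll es l ≡ σ l

-- (l , false) = l, (l , true) = l⁻¹
GLetter : Set
GLetter = Letter × Bool

GWord : Set
GWord = List GLetter

invPair : GLetter → GLetter → Bool
invPair (l , e) (m , f) = if l == m then (if e then not f else f) else false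

consR : GLetter → GWord → GWord
consR g [] = g ∷ []
consR g (h ∷ w) = if invPair g h then w else g ∷ h ∷ w

reduce : GWord → GWord
reduce = foldr consR []

ginv : GWord → GWord
ginv w = reverse (map (λ { (l , e) → l , not e }) w)

hom : (Letter → GWord) → GWord → GWord
hom τ w = reduce (concatMap (λ { (l , false) → τ l ; (l , true) → ginv (τ l) }) w)

pos : Word → GWord
pos = map (λ l → l , false)

IsAutF3 : Subst → Set
IsAutF3 σ = Σ (Letter → GWord) λ τ →
  (∀ l → hom τ (pos (σ l)) ≡ (l , false) ∷ []) ×
  (∀ l → hom (λ m → pos (σ m)) (τ l) ≡ (l , false) ∷ [])

σ₁ σ₂ σ₃ σ₄ σ₅ σ₆ σ₇ : Subst
σ₁ a = b ∷ a ∷ []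
σ₁ b = c ∷ a ∷ []
σ₁ c = b ∷ a ∷ c ∷ []
σ₂ a = a ∷ c ∷ []
σ₂ b = a ∷ b ∷ []
σ₂ c = a ∷ c ∷ b ∷ []
σ₃ a = c ∷ a ∷ []
σ₃ b = b ∷ a ∷ []
σ₃ c = c ∷ b ∷ a ∷ []
σ₄ a = a ∷ b ∷ []
σ₄ b = a ∷ c ∷ []
σ₄ c = b ∷ a ∷ c ∷ []
σ₅ a = b ∷ a ∷ []
σ₅ b = c ∷ b ∷ []
σ₅ c = a ∷ c ∷ a ∷ []
σ₆ a = a ∷ c ∷ []
σ₆ b = b ∷ a ∷ []
σ₆ c = c ∷ a ∷ b ∷ []
σ₇ a = c ∷ b ∷ []
σ₇ b = a ∷ c ∷ []
σ₇ c = a ∷ b ∷ a ∷ []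

-- Conversely,
-- every special Sturmian morphism φ of (x, y) keeps x inside φ(x) and y inside
-- φ(y), since each generator does and composition preserves this; the
-- projection π_{c→a}(σ₅) sends b to aaa and π_{b→c}(σ₇) sends a to cc.
-- (ii) The four factorisations into E, A, P are given explicitly.
-- (iii) Let F₃ act on {a, b, c} with a acting as the transposition (b c), b as
-- the cycle (a b c) and c as its inverse.  Each σ₆(l) fixes c, hence so does
-- every element of the subgroup generated by the σ₆(l); but a moves c, so a is
-- not in the image of σ₆.
module Submission where

open import Defs
open import Data.Bool using (true; false; not; if_then_else_)
open import Data.List using ([]; _∷_; _++_; foldr; concatMap)
open import Data.List.Properties using (foldr-++)
open import Data.List.Membership.Propositional using (_∈_; _∉_)
open import Data.List.Membership.Propositional.Properties using (∈-++⁺ˡ; ∈-++⁺ʳ)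
open import Data.List.Relation.Unary.Any using (here; there)
open import Data.Product using (_×_; _,_; proj₁; proj₂)
open import Function.Bundles using (_↔_; Inverse; mk↔ₛ′)
open import Function.Construct.Symmetry using (↔-sym)
open import Relation.Binary.PropositionalEquality
  using (_≡_; _≢_; refl; sym; trans; cong; ≢-sym; module ≡-Reasoning)
open import Relation.Nullary using (¬_)

==-refl : ∀ x → (x == x) ≡ true
==-refl a = refl
==-refl b = refl
==-refl c = refl

≢⇒==-false : ∀ {x y} → x ≢ y → (x == y) ≡ false
≢⇒==-false {a} {a} x≢y with () ← x≢y refl
≢⇒==-false {a} {b} _ = refl
≢⇒==-false {a} {c} _ = refl
≢⇒==-false {b} {a} _ = refl
≢⇒==-false {b} {b} x≢y with () ← x≢y refl
≢⇒==-false {b} {c} _ = refl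
≢⇒==-false {c} {a} _ = refl
≢⇒==-false {c} {b} _ = refl
≢⇒==-false {c} {c} x≢y with () ← x≢y refl

infixl 5 _▹_

_▹_ : ∀ {x y φ γ} → SpecialSturmian x y φ → SturmGen x y γ →
      SpecialSturmian x y (comp2 x y φ γ)
_▹_ = sstep

image2 : Letter → Letter → Mor2 → Letter → Word
image2 x y (u , v) l = if l == x then u else (if l == y then v else l ∷ [])

∈-apply2 : ∀ {x y φ l m w} → m ∈ image2 x y φ l → l ∈ w → m ∈ apply2 x y φ w
∈-apply2 m∈φl (here refl) = ∈-++⁺ˡ m∈φl
∈-apply2 {x} {y} {φ} {l} {w = k ∷ _} m∈φl (there l∈w) =
  ∈-++⁺ʳ (image2 x y φ k) (∈-apply2 m∈φl l∈w)

∈-image2ˣ : ∀ {x y φ} → x ∈ proj₁ φ → x ∈ image2 x y φ x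
∈-image2ˣ {x} x∈u rewrite ==-refl x = x∈u

∈-image2ʸ : ∀ {x y φ} → x ≢ y → y ∈ proj₂ φ → y ∈ image2 x y φ y
∈-image2ʸ {x} {y} x≢y y∈v rewrite ≢⇒==-false (≢-sym x≢y) | ==-refl y = y∈v

sturmGen-∈ : ∀ {x y γ} → SturmGen x y γ → x ∈ proj₁ γ × y ∈ proj₂ γ
sturmGen-∈ G  = here refl , there (here refl)
sturmGen-∈ G~ = here refl , here refl
sturmGen-∈ D  = there (here refl) , here refl
sturmGen-∈ D~ = here refl , here refl

specialSturmian-∈ : ∀ {x y φ} → x ≢ y → SpecialSturmian x y φ →
                    x ∈ proj₁ φ × y ∈ proj₂ φ
specialSturmian-∈ x≢y sid = here refl , here refl
specialSturmian-∈ x≢y (sstep ψ γ) with specialSturmian-∈ x≢y ψ | sturmGen-∈ γ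
... | x∈u , y∈v | x∈γx , y∈γy =
  ∈-apply2 (∈-image2ˣ x∈u) x∈γx , ∈-apply2 (∈-image2ʸ x≢y y∈v) y∈γy

invPair⇒inverse : ∀ {g l e} → invPair g (l , e) ≡ true → g ≡ (l , not e)
invPair⇒inverse {a , false} {a} {true}  _ = refl
invPair⇒inverse {a , true}  {a} {false} _ = refl
invPair⇒inverse {b , false} {b} {true}  _ = refl
invPair⇒inverse {b , true}  {b} {false} _ = refl
invPair⇒inverse {c , false} {c} {true}  _ = refl
invPair⇒inverse {c , true}  {c} {false} _ = refl
invPair⇒inverse {a , false} {a} {false} ()
invPair⇒inverse {a , true}  {a} {true}  ()
invPair⇒inverse {b , false} {b} {false} ()
invPair⇒inverse {b , true}  {b} {true}  ()
invPair⇒inverse {c , false} {c} {false} ()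
invPair⇒inverse {c , true}  {c} {true}  ()
invPair⇒inverse {a , _} {b} ()
invPair⇒inverse {a , _} {c} ()
invPair⇒inverse {b , _} {a} ()
invPair⇒inverse {b , _} {c} ()
invPair⇒inverse {c , _} {a} ()
invPair⇒inverse {c , _} {b} ()

module FreeGroupAction {X : Set} (ρ : Letter → X ↔ X) where
  open Inverse

  actˡ : GLetter → X → X
  actˡ (l , false) = to (ρ l)
  actˡ (l , true)  = from (ρ l)

  act : GWord → X → X
  act w x = foldr actˡ x w

  act-++ : ∀ u v x → act (u ++ v) x ≡ act u (act v x)
  act-++ u v x = foldr-++ actˡ x u v

  actˡ-cancel : ∀ g h x → invPair g h ≡ true → actˡ g (actˡ h x) ≡ x
  actˡ-cancel g (l , false) x inv with refl ← invPair⇒inverse {g} {l} {false} inv =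
    strictlyInverseʳ (ρ l) x
  actˡ-cancel g (l , true)  x inv with refl ← invPair⇒inverse {g} {l} {true} inv =
    strictlyInverseˡ (ρ l) x

  act-consR : ∀ g w x → act (consR g w) x ≡ actˡ g (act w x)
  act-consR g [] x = refl
  act-consR g (h ∷ w) x with invPair g h in inv
  ... | true  = sym (actˡ-cancel g h (act w x) inv)
  ... | false = refl

  act-reduce : ∀ w x → act (reduce w) x ≡ act w x
  act-reduce []      x = refl
  act-reduce (g ∷ w) x =
    trans (act-consR g (reduce w) x) (cong (actˡ g) (act-reduce w x))

  act-concatMap-fixes : ∀ (f : GLetter → GWord) {x} →
                        (∀ g → act (f g) x ≡ x) →
                        ∀ w → act (concatMap f w) x ≡ x
  act-concatMap-fixes f     fix []      = refl
  act-concatMap-fixes f {x} fix (g ∷ w) = begin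
    act (f g ++ concatMap f w) x   ≡⟨ act-++ (f g) (concatMap f w) x ⟩
    act (f g) (act (concatMap f w) x)
      ≡⟨ cong (act (f g)) (act-concatMap-fixes f fix w) ⟩
    act (f g) x                    ≡⟨ fix g ⟩
    x                              ∎
    where open ≡-Reasoning

  act-hom-fixes : ∀ τ {x} → (∀ l → act (τ l) x ≡ x) →
                  (∀ l → act (ginv (τ l)) x ≡ x) →
                  ∀ w → act (hom τ w) x ≡ x
  act-hom-fixes τ {x} fix fix⁻¹ w =
    trans (act-reduce (concatMap _ w) x)
          (act-concatMap-fixes _ (λ { (l , false) → fix l ; (l , true) → fix⁻¹ l }) w)

authentic₁ : AuthenticPWWF σ₁
authentic₁ = sid ▹ D ▹ G ▹ G , sid ▹ G ▹ G ▹ D , sid ▹ G~ ▹ G~ ▹ D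

authentic₂ : AuthenticPWWF σ₂
authentic₂ = sid ▹ D~ ▹ G ▹ G , sid ▹ G ▹ G~ ▹ D , sid ▹ G ▹ G ▹ D~

authentic₃ : AuthenticPWWF σ₃
authentic₃ = sid ▹ D ▹ G ▹ G~ , sid ▹ G~ ▹ G~ ▹ D , sid ▹ G ▹ G~ ▹ D~

authentic₄ : AuthenticPWWF σ₄
authentic₄ = sid ▹ D~ ▹ G ▹ G~ , sid ▹ G ▹ G ▹ D~ , sid ▹ G~ ▹ G~ ▹ D~

authentic₆ : AuthenticPWWF σ₆
authentic₆ = sid ▹ D~ ▹ G~ ▹ G~ , sid ▹ G~ ▹ G~ ▹ D~ , sid ▹ G ▹ G ▹ D

¬authentic₅ : ¬ AuthenticPWWF σ₅
¬authentic₅ (_ , _ , ψ) = b∉aaa (proj₂ (specialSturmian-∈ (λ ()) ψ))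
  where
  b∉aaa : b ∉ a ∷ a ∷ a ∷ []
  b∉aaa (here ())
  b∉aaa (there (here ()))
  b∉aaa (there (there (here ())))
  b∉aaa (there (there (there ())))

¬authentic₇ : ¬ AuthenticPWWF σ₇
¬authentic₇ (ψ , _ , _) = a∉cc (proj₁ (specialSturmian-∈ (λ ()) ψ))
  where
  a∉cc : a ∉ c ∷ c ∷ []
  a∉cc (here ())
  a∉cc (there (here ()))
  a∉cc (there (there ()))

eap₁ : IsEAPComposition σ₁
eap₁ = E a b (λ ()) ∷ A a b (λ ()) ∷ P b c (λ ()) ∷ P c a (λ ()) ∷ []
     , λ { a → refl ; b → refl ; c → refl }

eap₂ : IsEAPComposition σ₂
eap₂ = E a b (λ ()) ∷ E a c (λ ()) ∷ P a b (λ ()) ∷ A b c (λ ()) ∷ P c a (λ ()) ∷ []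
     , λ { a → refl ; b → refl ; c → refl }

eap₃ : IsEAPComposition σ₃
eap₃ = A b a (λ ()) ∷ P a c (λ ()) ∷ A c b (λ ()) ∷ []
     , λ { a → refl ; b → refl ; c → refl }

eap₄ : IsEAPComposition σ₄
eap₄ = E b c (λ ()) ∷ P b a (λ ()) ∷ A a c (λ ()) ∷ A c b (λ ()) ∷ []
     , λ { a → refl ; b → refl ; c → refl }

swapᵇᶜ : Letter → Letter
swapᵇᶜ a = a
swapᵇᶜ b = c
swapᵇᶜ c = b

swapᵇᶜ-involutive : ∀ l → swapᵇᶜ (swapᵇᶜ l) ≡ l
swapᵇᶜ-involutive a = refl
swapᵇᶜ-involutive b = refl
swapᵇᶜ-involutive c = refl

next prev : Letter → Letter
next a = b
next b = c
next c = a
prev a = c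
prev b = a
prev c = b

next-prev : ∀ l → next (prev l) ≡ l
next-prev a = refl
next-prev b = refl
next-prev c = refl

prev-next : ∀ l → prev (next l) ≡ l
prev-next a = refl
prev-next b = refl
prev-next c = refl

rotation : Letter ↔ Letter
rotation = mk↔ₛ′ next prev next-prev prev-next

S₃-action : Letter → Letter ↔ Letter
S₃-action a = mk↔ₛ′ swapᵇᶜ swapᵇᶜ swapᵇᶜ-involutive swapᵇᶜ-involutive
S₃-action b = rotation
S₃-action c = ↔-sym rotation

¬autF3₆ : ¬ IsAutF3 σ₆
¬autF3₆ (τ , _ , σ₆∘τ≡id) = c≢b
  (trans (sym (act-hom-fixes (λ l → pos (σ₆ l)) σ₆-fixes σ₆⁻¹-fixes (τ a)))
         (cong (λ w → act w c) (σ₆∘τ≡id a)))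
  where
  open FreeGroupAction S₃-action
  c≢b : c ≢ b
  c≢b ()
  σ₆-fixes : ∀ l → act (pos (σ₆ l)) c ≡ c
  σ₆-fixes a = refl
  σ₆-fixes b = refl
  σ₆-fixes c = refl
  σ₆⁻¹-fixes : ∀ l → act (ginv (pos (σ₆ l))) c ≡ c
  σ₆⁻¹-fixes a = refl
  σ₆⁻¹-fixes b = refl
  σ₆⁻¹-fixes c = refl

proposition5 :
    (AuthenticPWWF σ₁ × AuthenticPWWF σ₂ × AuthenticPWWF σ₃ ×
     AuthenticPWWF σ₄ × AuthenticPWWF σ₆ ×
     ¬ AuthenticPWWF σ₅ × ¬ AuthenticPWWF σ₇)
    ×
    (IsEAPComposition σ₁ × IsEAPComposition σ₂ ×
     IsEAPComposition σ₃ × IsEAPComposition σ₄)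
    ×
    ¬ IsAutF3 σ₆
proposition5 =
  ( authentic₁ , authentic₂ , authentic₃ , authentic₄ , authentic₆
  , ¬authentic₅ , ¬authentic₇ )
  , (eap₁ , eap₂ , eap₃ , eap₄)
  , ¬autF3₆
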